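{- Let $q=2^e$ with $e>1$ odd, $\sigma=2^{(e+1)/2}$, let $\delta\in\mathbb{F}_q$ have absolute trace $1$ and let $\epsilon\in\mathbb{F}_{q^2}\setminus\mathbb{F}_q$ satisfy $\epsilon^2+\epsilon+\delta=0$. Let $\mathcal{C}^3_\varepsilon$ be the hypersurface of $\mathrm{PG}(6,q)$ with equation \[ x_0^{\sigma+1}x_6=x_1^{\sigma+2}+x_0^{\sigma}x_1x_2+x_0^2x_2^{\sigma}+x_3^{\sigma+2}+x_0^{\sigma}x_3x_4+x_0^2x_4^{\sigma}. \] Then a line $r_P$ of the spread $\mathcal{S}$ is entirely contained in $\mathcal{C}^3_\varepsilon$ if and only if either $P=P_\infty=(0,0,0,1)$ or $P=(0,1,1,h)$ for some $h\in\mathbb{F}_{q^2}$.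
   Context: Points of $\mathrm{PG}(3,q^2)$ have homogeneous coordinates $(J,X,Y,Z)$ and points of $\mathrm{PG}(6,q)$ have homogeneous coordinates $(x_0,\dots,x_6)$; $x^{\sigma+m}$ means $x^{2^{(e+1)/2}+m}$. Every $c\in\mathbb{F}_{q^2}$ is written uniquely as $c=c_0+\epsilon c_1$ with $c_0,c_1\in\mathbb{F}_q$. For a point $P=(0,u,v,w)$ of the plane $J=0$ of $\mathrm{PG}(3,q^2)$, $r_P$ is the line of the hyperplane $x_0=0$ of $\mathrm{PG}(6,q)$ consisting of the points $(0,u'_0,u'_1,v'_0,v'_1,w'_0,w'_1)$ with $(u',v',w')=(\lambda u,\lambda v,\lambda w)$, $\lambda\in\mathbb{F}_{q^2}^*$; the set $\mathcal{S}$ of all such lines is a Desarguesian line spread of $\{x_0=0\}$ (Barlotti--Cofman representation). -}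

module Defs where

open import Data.Nat using (ℕ; zero; suc) renaming (_+_ to _+ℕ_; _^_ to _^ℕ_)
open import Data.Fin using (Fin)
open import Data.Product using (Σ; _×_; _,_; proj₁; proj₂)
open import Data.Sum using (_⊎_)
open import Relation.Nullary using (¬_)
open import Relation.Binary.PropositionalEquality using (_≡_)
open import Algebra.Structures using (IsCommutativeRing)
open import Function.Bundles using (_↔_)

record FiniteField (n : ℕ) : Set₁ where
  infixl 6 _+_
  infixl 7 _*_
  field
    Carrier : Set
    _+_ _*_ : Carrier → Carrier → Carrier
    -_      : Carrier → Carrier
    0# 1#   : Carrier
    isCommutativeRing : IsCommutativeRing _≡_ _+_ _*_ -_ 0# 1#
    0≢1     : ¬ (0# ≡ 1#)
    inverse : ∀ x → ¬ (x ≡ 0#) → Σ Carrier (λ y → x * y ≡ 1#)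
    card    : Carrier ↔ Fin n

module FieldOps {n : ℕ} (F : FiniteField n) where
  open FiniteField F

  infixr 8 _^_
  _^_ : Carrier → ℕ → Carrier
  x ^ zero  = 1#
  x ^ suc m = x * (x ^ m)

  trace : ℕ → Carrier → Carrier
  trace zero    x = 0#
  trace (suc i) x = trace i x + x ^ (2 ^ℕ i)

  -- F_{q^2} = F_q(ε) with ε² + ε + δ = 0; c = c₀ + ε c₁ is the pair (c₀ , c₁).
  F2 : Set
  F2 = Carrier × Carrier

  0₂ : F2
  0₂ = 0# , 0#

  1₂ : F2
  1₂ = 1# , 0#

  -- multiplication in F_q(ε), using ε² = - ε - δ
  mul₂ : Carrier → F2 → F2 → F2
  mul₂ δ (a₀ , a₁) (b₀ , b₁) =
    (a₀ * b₀ + - (δ * (a₁ * b₁))) , (a₀ * b₁ + a₁ * b₀ + - (a₁ * b₁))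

  onC : ℕ → Carrier → Carrier → Carrier → Carrier → Carrier → Carrier → Carrier → Set
  onC σ x₀ x₁ x₂ x₃ x₄ x₅ x₆ =
    x₀ ^ (σ +ℕ 1) * x₆ ≡
      x₁ ^ (σ +ℕ 2) + x₀ ^ σ * x₁ * x₂ + x₀ ^ 2 * x₂ ^ σ
      + x₃ ^ (σ +ℕ 2) + x₀ ^ σ * x₃ * x₄ + x₀ ^ 2 * x₄ ^ σ

  NonZero3 : F2 → F2 → F2 → Set
  NonZero3 u v w = ¬ ((u ≡ 0₂) × (v ≡ 0₂) × (w ≡ 0₂))

  -- (0,u,v,w) and (0,u',v',w') are the same point of PG(3,q^2)
  SamePoint : Carrier → F2 → F2 → F2 → F2 → F2 → F2 → Set
  SamePoint δ u v w u' v' w' =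
    Σ F2 (λ μ → ¬ (μ ≡ 0₂) × (mul₂ δ μ u' ≡ u) × (mul₂ δ μ v' ≡ v) × (mul₂ δ μ w' ≡ w))

  -- the spread line r_P, P = (0,u,v,w), is entirely contained in C^3_ε
  LineInC : ℕ → Carrier → F2 → F2 → F2 → Set
  LineInC σ δ u v w = ∀ (λ' : F2) → ¬ (λ' ≡ 0₂) →
    onC σ 0# (proj₁ (mul₂ δ λ' u)) (proj₂ (mul₂ δ λ' u))
             (proj₁ (mul₂ δ λ' v)) (proj₂ (mul₂ δ λ' v))
             (proj₁ (mul₂ δ λ' w)) (proj₂ (mul₂ δ λ' w))

{-# OPTIONS --safe #-}
-- On the hyperplane x₀ = 0 the equation of C reduces, in characteristic two, to
-- x₁ ^ (σ + 2) = x₃ ^ (σ + 2).  As σ + 2 = 2 (2^k + 1) and 1 is the only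
-- (2^k + 1)-th root of unity in F_{2^(2k+1)}, the map x ↦ x ^ (σ + 2) is injective,
-- so r_P ⊆ C iff λu and λv have equal first coordinates for all λ, i.e. (taking
-- λ = 1 and λ = ε) iff u = v.  The points with u = v are P∞ and, for u ≠ 0, the
-- point (0, 1, 1, w / u); dividing by u needs F_q(ε) to be a field, i.e.
-- t² + t = δ to have no root in F_q, which is what Tr δ = 1 guarantees.
module Submission where

open import Defs
open import Data.Nat as ℕ using (ℕ; zero; suc; NonZero)
import Data.Nat.Properties as ℕ
open import Data.Bool as Bool using (Bool; true; false)
import Data.Bool.Properties as Bool
open import Data.Fin as Fin using (Fin; punchIn)
import Data.Fin.Properties as Fin
open import Data.Fin.Permutation as Perm using (Permutation)
open import Data.Product using (Σ; _×_; _,_; proj₁; proj₂)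
open import Data.Product.Properties using (≡-dec)
open import Data.Sum using (_⊎_; inj₁; inj₂)
import Data.Maybe as Maybe
open import Relation.Nullary using (¬_; yes; no; contradiction)
open import Relation.Nullary.Decidable using (via-injection; dec⇒maybe)
open import Relation.Binary.Definitions using (DecidableEquality)
open import Relation.Binary.PropositionalEquality
open import Function.Bundles using (_↔_; Inverse; _⇔_; mk⇔; Equivalence)
open import Function.Construct.Composition using (_⇔-∘_)
open import Function.Properties.Inverse using (↔⇒↣)
open import Algebra.Bundles using (CommutativeRing)
open import Algebra.Structures using (IsCommutativeRing)
open import Algebra.Solver.Ring.AlmostCommutativeRing
  using (fromCommutativeRing; _-Raw-AlmostCommutative⟶_)

2^[2k+1]≡2^k*2^k*2 : ∀ k → 2 ℕ.^ (2 ℕ.* k ℕ.+ 1) ≡ 2 ℕ.^ k ℕ.* 2 ℕ.^ k ℕ.* 2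
2^[2k+1]≡2^k*2^k*2 k = begin
  2 ℕ.^ (k ℕ.+ (k ℕ.+ 0) ℕ.+ 1)      ≡⟨ ℕ.^-distribˡ-+-* 2 (k ℕ.+ (k ℕ.+ 0)) 1 ⟩
  2 ℕ.^ (k ℕ.+ (k ℕ.+ 0)) ℕ.* 2      ≡⟨ cong (λ i → 2 ℕ.^ (k ℕ.+ i) ℕ.* 2) (ℕ.+-identityʳ k) ⟩
  2 ℕ.^ (k ℕ.+ k) ℕ.* 2              ≡⟨ cong (ℕ._* 2) (ℕ.^-distribˡ-+-* 2 k k) ⟩
  2 ℕ.^ k ℕ.* 2 ℕ.^ k ℕ.* 2          ∎
  where open ≡-Reasoning

2^[k+1]+2≡[2^k+1]*2 : ∀ k → 2 ℕ.^ (k ℕ.+ 1) ℕ.+ 2 ≡ (2 ℕ.^ k ℕ.+ 1) ℕ.* 2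
2^[k+1]+2≡[2^k+1]*2 k = begin
  2 ℕ.^ (k ℕ.+ 1) ℕ.+ 2          ≡⟨ cong (ℕ._+ 2) (ℕ.^-distribˡ-+-* 2 k 1) ⟩
  2 ℕ.^ k ℕ.* 2 ℕ.+ 1 ℕ.* 2      ≡⟨ ℕ.*-distribʳ-+ 2 (2 ℕ.^ k) 1 ⟨
  (2 ℕ.^ k ℕ.+ 1) ℕ.* 2          ∎
  where open ≡-Reasoning

module FiniteFieldProperties {n : ℕ} (F : FiniteField n) where
  open FiniteField F
  open FieldOps F
  open IsCommutativeRing isCommutativeRing
    using (-‿inverseʳ; *-assoc; *-comm; *-identityˡ; *-identityʳ; zeroˡ; zeroʳ)
  open ≡-Reasoning

  commutativeRing : CommutativeRing _ _
  commutativeRing = record { isCommutativeRing = isCommutativeRing }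

  open import Algebra.Properties.Ring (CommutativeRing.ring commutativeRing)
    using (-1*x≈-x; -‿involutive)
  open import Algebra.Properties.CommutativeSemigroup
    (CommutativeRing.*-commutativeSemigroup commutativeRing) using (interchange)
  open import Algebra.Properties.CommutativeMonoid.Sum
    (CommutativeRing.*-commutativeMonoid commutativeRing)
    using (sum-remove; sum-permute; sum-cong-≗) renaming (sum to ∏)

  infix 4 _≟_
  _≟_ : DecidableEquality Carrier
  _≟_ = via-injection (↔⇒↣ card) Fin._≟_

  1≢0 : ¬ 1# ≡ 0#
  1≢0 1≡0 = 0≢1 (sym 1≡0)

  inv : (x : Carrier) → ¬ x ≡ 0# → Carrier
  inv x x≢0 = proj₁ (inverse x x≢0)

  *-inverseʳ : ∀ {x} (x≢0 : ¬ x ≡ 0#) → x * inv x x≢0 ≡ 1#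
  *-inverseʳ {x} x≢0 = proj₂ (inverse x x≢0)

  inverse-cancelˡ : ∀ {x} (x≢0 : ¬ x ≡ 0#) y → x * (inv x x≢0 * y) ≡ y
  inverse-cancelˡ {x} x≢0 y = begin
    x * (inv x x≢0 * y)   ≡⟨ *-assoc x _ y ⟨
    x * inv x x≢0 * y     ≡⟨ cong (_* y) (*-inverseʳ x≢0) ⟩
    1# * y                ≡⟨ *-identityˡ y ⟩
    y                     ∎

  inverse-cancelʳ : ∀ {x} (x≢0 : ¬ x ≡ 0#) y → inv x x≢0 * (x * y) ≡ y
  inverse-cancelʳ {x} x≢0 y = begin
    inv x x≢0 * (x * y)   ≡⟨ *-assoc _ x y ⟨
    inv x x≢0 * x * y     ≡⟨ cong (_* y) (trans (*-comm _ x) (*-inverseʳ x≢0)) ⟩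
    1# * y                ≡⟨ *-identityˡ y ⟩
    y                     ∎

  *-cancelˡ-≢0 : ∀ {x y z} → ¬ x ≡ 0# → x * y ≡ x * z → y ≡ z
  *-cancelˡ-≢0 {x} {y} {z} x≢0 xy≡xz = begin
    y                     ≡⟨ inverse-cancelʳ x≢0 y ⟨
    inv x x≢0 * (x * y)   ≡⟨ cong (inv x x≢0 *_) xy≡xz ⟩
    inv x x≢0 * (x * z)   ≡⟨ inverse-cancelʳ x≢0 z ⟩
    z                     ∎

  *-cancelʳ-≢0 : ∀ {x y z} → ¬ z ≡ 0# → x * z ≡ y * z → x ≡ y
  *-cancelʳ-≢0 {x} {y} {z} z≢0 xz≡yz =
    *-cancelˡ-≢0 z≢0 (trans (*-comm z x) (trans xz≡yz (*-comm y z)))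

  *-≢0 : ∀ {x y} → ¬ x ≡ 0# → ¬ y ≡ 0# → ¬ x * y ≡ 0#
  *-≢0 {x} x≢0 y≢0 xy≡0 = y≢0 (*-cancelˡ-≢0 x≢0 (trans xy≡0 (sym (zeroʳ x))))

  1^n≡1 : ∀ m → 1# ^ m ≡ 1#
  1^n≡1 zero    = refl
  1^n≡1 (suc m) = trans (*-identityˡ _) (1^n≡1 m)

  ^-homo-* : ∀ x m k → x ^ (m ℕ.+ k) ≡ x ^ m * x ^ k
  ^-homo-* x zero    k = sym (*-identityˡ _)
  ^-homo-* x (suc m) k = trans (cong (x *_) (^-homo-* x m k)) (sym (*-assoc x _ _))

  ^-distrib-* : ∀ x y m → (x * y) ^ m ≡ x ^ m * y ^ m
  ^-distrib-* x y zero    = sym (*-identityˡ 1#)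
  ^-distrib-* x y (suc m) = trans (cong ((x * y) *_) (^-distrib-* x y m)) (interchange x y _ _)

  ^-assocʳ : ∀ x m k → (x ^ m) ^ k ≡ x ^ (m ℕ.* k)
  ^-assocʳ x zero    k = 1^n≡1 k
  ^-assocʳ x (suc m) k = begin
    (x * x ^ m) ^ k         ≡⟨ ^-distrib-* x (x ^ m) k ⟩
    x ^ k * (x ^ m) ^ k     ≡⟨ cong (x ^ k *_) (^-assocʳ x m k) ⟩
    x ^ k * x ^ (m ℕ.* k)   ≡⟨ ^-homo-* x k (m ℕ.* k) ⟨
    x ^ (k ℕ.+ m ℕ.* k)     ∎

  ^-≢0 : ∀ {x} m → ¬ x ≡ 0# → ¬ x ^ m ≡ 0#
  ^-≢0 zero    x≢0 = 1≢0
  ^-≢0 (suc m) x≢0 = *-≢0 x≢0 (^-≢0 m x≢0)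

  ^≡0⇒≡0 : ∀ {x} m → x ^ m ≡ 0# → x ≡ 0#
  ^≡0⇒≡0 {x} m x^m≡0 with x ≟ 0#
  ... | yes x≡0 = x≡0
  ... | no  x≢0 = contradiction x^m≡0 (^-≢0 m x≢0)

  nonzeroOr1 : Carrier → Carrier
  nonzeroOr1 x with x ≟ 0#
  ... | yes _ = 1#
  ... | no  _ = x

  nonzeroOr1-0 : nonzeroOr1 0# ≡ 1#
  nonzeroOr1-0 with 0# ≟ 0#
  ... | yes _   = refl
  ... | no  0≢0 = contradiction refl 0≢0

  nonzeroOr1-≢0 : ∀ {x} → ¬ x ≡ 0# → nonzeroOr1 x ≡ x
  nonzeroOr1-≢0 {x} x≢0 with x ≟ 0#
  ... | yes x≡0 = contradiction x≡0 x≢0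
  ... | no  _   = refl

  ∏-scale : ∀ {m} a (r : Fin m → Carrier) → ∏ (λ j → a * r j) ≡ a ^ m * ∏ r
  ∏-scale {zero}  a r = sym (*-identityˡ 1#)
  ∏-scale {suc m} a r =
    trans (cong (a * r Fin.zero *_) (∏-scale a (λ j → r (Fin.suc j))))
          (interchange a (r Fin.zero) _ _)

  ∏-≢0 : ∀ {m} {r : Fin m → Carrier} → (∀ j → ¬ r j ≡ 0#) → ¬ ∏ r ≡ 0#
  ∏-≢0 {zero}  r≢0 = 1≢0
  ∏-≢0 {suc m} r≢0 = *-≢0 (r≢0 Fin.zero) (∏-≢0 (λ j → r≢0 (Fin.suc j)))

  -- Fermat's little theorem: multiplying by a ≠ 0 permutes the nonzero elements,
  -- so their product U satisfies a ^ m * U ≡ U.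
  module _ {m : ℕ} (card′ : Carrier ↔ Fin (suc m)) where
    open Inverse card′ using (to; from; strictlyInverseˡ; strictlyInverseʳ)

    private
      nonzero : Fin m → Carrier
      nonzero j = from (punchIn (to 0#) j)

      nonzero-≢0 : ∀ j → ¬ nonzero j ≡ 0#
      nonzero-≢0 j j≡0 =
        Fin.punchInᵢ≢i (to 0#) j (trans (sym (strictlyInverseˡ _)) (cong to j≡0))

      scaling : ∀ {a} → ¬ a ≡ 0# → Permutation (suc m) (suc m)
      scaling {a} a≢0 = Perm.permutation
        (λ i → to (a * from i)) (λ i → to (inv a a≢0 * from i))
        (λ i → trans (cong (λ x → to (a * x)) (strictlyInverseʳ _))
                     (trans (cong to (inverse-cancelˡ a≢0 _)) (strictlyInverseˡ i)))
        (λ i → trans (cong (λ x → to (inv a a≢0 * x)) (strictlyInverseʳ _))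
                     (trans (cong to (inverse-cancelʳ a≢0 _)) (strictlyInverseˡ i)))

      ∏-scaling-invariant : ∀ {a} → ¬ a ≡ 0# → (f : Carrier → Carrier) →
                            ∏ (λ i → f (from i)) ≡ ∏ (λ i → f (a * from i))
      ∏-scaling-invariant {a} a≢0 f =
        trans (sum-permute (λ i → f (from i)) (scaling a≢0))
              (sum-cong-≗ {y = λ i → f (a * from i)} (λ i → cong f (strictlyInverseʳ _)))

      ∏-nonzeroOr1-scaled : ∀ {a} → ¬ a ≡ 0# →
                            ∏ (λ i → nonzeroOr1 (a * from i)) ≡ a ^ m * ∏ nonzero
      ∏-nonzeroOr1-scaled {a} a≢0 = begin
        ∏ (λ i → nonzeroOr1 (a * from i))
          ≡⟨ sum-remove {i = to 0#} (λ i → nonzeroOr1 (a * from i)) ⟩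
        nonzeroOr1 (a * from (to 0#)) * ∏ (λ j → nonzeroOr1 (a * nonzero j))
          ≡⟨ cong₂ _*_ at-zero (sum-cong-≗ (λ j → nonzeroOr1-≢0 (*-≢0 a≢0 (nonzero-≢0 j)))) ⟩
        1# * ∏ (λ j → a * nonzero j)
          ≡⟨ *-identityˡ _ ⟩
        ∏ (λ j → a * nonzero j)
          ≡⟨ ∏-scale a nonzero ⟩
        a ^ m * ∏ nonzero
          ∎
        where
        at-zero : nonzeroOr1 (a * from (to 0#)) ≡ 1#
        at-zero = trans (cong (λ x → nonzeroOr1 (a * x)) (strictlyInverseʳ 0#))
                        (trans (cong nonzeroOr1 (zeroʳ a)) nonzeroOr1-0)

    ^[q-1]≡1 : ∀ {a} → ¬ a ≡ 0# → a ^ m ≡ 1#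
    ^[q-1]≡1 {a} a≢0 = *-cancelʳ-≢0 (∏-≢0 nonzero-≢0) (begin
      a ^ m * ∏ nonzero                    ≡⟨ ∏-nonzeroOr1-scaled a≢0 ⟨
      ∏ (λ i → nonzeroOr1 (a * from i))    ≡⟨ ∏-scaling-invariant a≢0 nonzeroOr1 ⟨
      ∏ (λ i → nonzeroOr1 (from i))        ≡⟨ ∏-scaling-invariant 1≢0 nonzeroOr1 ⟩
      ∏ (λ i → nonzeroOr1 (1# * from i))   ≡⟨ ∏-nonzeroOr1-scaled 1≢0 ⟩
      1# ^ m * ∏ nonzero                   ≡⟨ cong (_* ∏ nonzero) (1^n≡1 m) ⟩
      1# * ∏ nonzero                       ∎)

  fermat : ∀ x → x ^ n ≡ x
  fermat = fermat′ card
    where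
    fermat′ : ∀ {m} → Carrier ↔ Fin m → ∀ x → x ^ m ≡ x
    fermat′ {zero}  card′ x with Inverse.to card′ x
    ... | ()
    fermat′ {suc m} card′ x with x ≟ 0#
    ... | yes refl = zeroˡ _
    ... | no  x≢0  = trans (cong (x *_) (^[q-1]≡1 card′ x≢0)) (*-identityʳ x)

  characteristic-two : ∀ j → n ≡ 2 ℕ.* j → 1# + 1# ≡ 0#
  characteristic-two j n≡2j = trans (cong (1# +_) (sym -1≡1)) (-‿inverseʳ 1#)
    where
    -1≡1 : - 1# ≡ 1#
    -1≡1 = begin
      - 1#                 ≡⟨ fermat (- 1#) ⟨
      (- 1#) ^ n           ≡⟨ cong ((- 1#) ^_) n≡2j ⟩
      (- 1#) ^ (2 ℕ.* j)   ≡⟨ ^-assocʳ (- 1#) 2 j ⟨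
      ((- 1#) ^ 2) ^ j     ≡⟨ cong (_^ j) [-1]²≡1 ⟩
      1# ^ j               ≡⟨ 1^n≡1 j ⟩
      1#                   ∎
      where
      [-1]²≡1 : (- 1#) ^ 2 ≡ 1#
      [-1]²≡1 = trans (cong (- 1# *_) (*-identityʳ _))
                      (trans (-1*x≈-x (- 1#)) (-‿involutive 1#))

  module _ (c : ℕ) (kernel-trivial : ∀ {z} → z ^ c ≡ 1# → z ≡ 1#) where
    private
      ^-cancel : ∀ {x y} → ¬ y ≡ 0# → x ^ c ≡ y ^ c → x ≡ y
      ^-cancel {x} {y} y≢0 x^c≡y^c = begin
        x        ≡⟨ inverse-cancelˡ y≢0 x ⟨
        y * z    ≡⟨ cong (y *_) (kernel-trivial z^c≡1) ⟩
        y * 1#   ≡⟨ *-identityʳ y ⟩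
        y        ∎
        where
        z = inv y y≢0 * x
        z^c≡1 : z ^ c ≡ 1#
        z^c≡1 = *-cancelˡ-≢0 (^-≢0 c y≢0) (begin
          y ^ c * z ^ c   ≡⟨ ^-distrib-* y z c ⟨
          (y * z) ^ c     ≡⟨ cong (_^ c) (inverse-cancelˡ y≢0 x) ⟩
          x ^ c           ≡⟨ x^c≡y^c ⟩
          y ^ c           ≡⟨ *-identityʳ _ ⟨
          y ^ c * 1#      ∎)

    ^-injective : ∀ {x y} → x ^ c ≡ y ^ c → x ≡ y
    ^-injective {x} {y} x^c≡y^c with x ≟ 0# | y ≟ 0#
    ... | yes x≡0 | yes y≡0 = trans x≡0 (sym y≡0)
    ... | _       | no  y≢0 = ^-cancel y≢0 x^c≡y^c
    ... | no  x≢0 | yes _   = sym (^-cancel x≢0 (sym x^c≡y^c))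

  -- With w = z ^ 2^k one has w * z ≡ 1, hence w ^ 2^k ≡ z, and then
  -- z ≡ z ^ 2^(2k+1) ≡ (w ^ 2^k) ^ 2 ≡ z ^ 2.
  ^[2^k+1]≡1⇒≡1 : ∀ k {z} → n ≡ 2 ℕ.^ (2 ℕ.* k ℕ.+ 1) →
                  z ^ (2 ℕ.^ k ℕ.+ 1) ≡ 1# → z ≡ 1#
  ^[2^k+1]≡1⇒≡1 k {z} n≡q z^c≡1 = *-cancelˡ-≢0 z≢0 (begin
    z * z                         ≡⟨ cong (z *_) (*-identityʳ z) ⟨
    z ^ 2                         ≡⟨ cong (_^ 2) w^2^k≡z ⟨
    (w ^ 2^k) ^ 2                 ≡⟨ cong (_^ 2) (^-assocʳ z 2^k 2^k) ⟩
    (z ^ (2^k ℕ.* 2^k)) ^ 2       ≡⟨ ^-assocʳ z (2^k ℕ.* 2^k) 2 ⟩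
    z ^ (2^k ℕ.* 2^k ℕ.* 2)       ≡⟨ cong (z ^_) (2^[2k+1]≡2^k*2^k*2 k) ⟨
    z ^ (2 ℕ.^ (2 ℕ.* k ℕ.+ 1))   ≡⟨ cong (z ^_) n≡q ⟨
    z ^ n                         ≡⟨ fermat z ⟩
    z                             ≡⟨ *-identityʳ z ⟨
    z * 1#                        ∎)
    where
    2^k = 2 ℕ.^ k
    w = z ^ 2^k

    w*z≡1 : w * z ≡ 1#
    w*z≡1 = trans (cong (w *_) (sym (*-identityʳ z))) (trans (sym (^-homo-* z 2^k 1)) z^c≡1)

    z≢0 : ¬ z ≡ 0#
    z≢0 z≡0 = 1≢0 (trans (sym w*z≡1) (trans (cong (w *_) z≡0) (zeroʳ w)))

    w≢0 : ¬ w ≡ 0#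
    w≢0 w≡0 = 1≢0 (trans (sym w*z≡1) (trans (cong (_* z) w≡0) (zeroˡ z)))

    w^2^k≡z : w ^ 2^k ≡ z
    w^2^k≡z = *-cancelʳ-≢0 w≢0 (begin
      w ^ 2^k * w         ≡⟨ ^-distrib-* w z 2^k ⟨
      (w * z) ^ 2^k       ≡⟨ cong (_^ 2^k) w*z≡1 ⟩
      1# ^ 2^k            ≡⟨ 1^n≡1 2^k ⟩
      1#                  ≡⟨ trans (*-comm z w) w*z≡1 ⟨
      z * w               ∎)

  ^[2^k+1]-injective : ∀ k {x y} → n ≡ 2 ℕ.^ (2 ℕ.* k ℕ.+ 1) →
                       x ^ (2 ℕ.^ k ℕ.+ 1) ≡ y ^ (2 ℕ.^ k ℕ.+ 1) → x ≡ y
  ^[2^k+1]-injective k n≡q = ^-injective (2 ℕ.^ k ℕ.+ 1) (^[2^k+1]≡1⇒≡1 k n≡q)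

module CharacteristicTwo {n : ℕ} (F : FiniteField n)
       (1+1≡0 : FiniteField._+_ F (FiniteField.1# F) (FiniteField.1# F) ≡ FiniteField.0# F) where
  open FiniteField F
  open FieldOps F
  open FiniteFieldProperties F
  open IsCommutativeRing isCommutativeRing
    using (+-identityˡ; +-identityʳ; -‿inverseˡ; +-assoc; zeroˡ; *-identityˡ)
  open import Algebra.Properties.Ring (CommutativeRing.ring commutativeRing) using (-0#≈0#)
  open ≡-Reasoning

  -1≡1 : - 1# ≡ 1#
  -1≡1 = begin
    - 1#                 ≡⟨ +-identityʳ _ ⟨
    - 1# + 0#            ≡⟨ cong (- 1# +_) 1+1≡0 ⟨
    - 1# + (1# + 1#)     ≡⟨ +-assoc _ _ _ ⟨
    - 1# + 1# + 1#       ≡⟨ cong (_+ 1#) (-‿inverseˡ 1#) ⟩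
    0# + 1#              ≡⟨ +-identityˡ _ ⟩
    1#                   ∎

  -- Ring identities of characteristic two are decided by the ring solver with
  -- coefficients in 𝔽₂, here the Boolean ring (xor, ∧).
  bit : Bool → Carrier
  bit true  = 1#
  bit false = 0#

  𝔽₂⟶F : CommutativeRing.rawRing Bool.xor-∧-commutativeRing
           -Raw-AlmostCommutative⟶ fromCommutativeRing commutativeRing
  𝔽₂⟶F = record
    { ⟦_⟧    = bit
    ; +-homo = +-homo
    ; *-homo = *-homo
    ; -‿homo = -‿homo
    ; 0-homo = refl
    ; 1-homo = refl
    }
    where
    +-homo : ∀ a b → bit (a Bool.xor b) ≡ bit a + bit b
    +-homo false b    = sym (+-identityˡ _)
    +-homo true false = sym (+-identityʳ 1#)
    +-homo true true  = sym 1+1≡0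
    *-homo : ∀ a b → bit (a Bool.∧ b) ≡ bit a * bit b
    *-homo false b = sym (zeroˡ _)
    *-homo true  b = sym (*-identityˡ _)
    -‿homo : ∀ a → bit a ≡ - bit a
    -‿homo false = sym -0#≈0#
    -‿homo true  = sym -1≡1

  open import Algebra.Solver.Ring _ _ 𝔽₂⟶F
    (λ a b → Maybe.map (cong bit) (dec⇒maybe (a Bool.≟ b))) public

  x+x≡0 : ∀ x → x + x ≡ 0#
  x+x≡0 = solve 1 (λ x → x :+ x := con false) refl

  x+y≡0⇒x≡y : ∀ {x y} → x + y ≡ 0# → x ≡ y
  x+y≡0⇒x≡y {x} {y} x+y≡0 = begin
    x             ≡⟨ solve 2 (λ x y → x := (x :+ y) :+ y) refl x y ⟩
    x + y + y     ≡⟨ cong (_+ y) x+y≡0 ⟩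
    0# + y        ≡⟨ +-identityˡ y ⟩
    y             ∎

  x≡y⇒x+y≡0 : ∀ {x y} → x ≡ y → x + y ≡ 0#
  x≡y⇒x+y≡0 {x} refl = x+x≡0 x

  square-injective : ∀ {x y} → x ^ 2 ≡ y ^ 2 → x ≡ y
  square-injective {x} {y} x²≡y² = x+y≡0⇒x≡y (^≡0⇒≡0 2 (begin
    (x + y) ^ 2       ≡⟨ solve 2 (λ x y → (x :+ y) :^ 2 := x :^ 2 :+ y :^ 2) refl x y ⟩
    x ^ 2 + y ^ 2     ≡⟨ x≡y⇒x+y≡0 x²≡y² ⟩
    0#                ∎))

  frobenius-homo-+ : ∀ j x y → (x + y) ^ (2 ℕ.^ j) ≡ x ^ (2 ℕ.^ j) + y ^ (2 ℕ.^ j)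
  frobenius-homo-+ zero    x y = solve 2 (λ x y → (x :+ y) :^ 1 := x :^ 1 :+ y :^ 1) refl x y
  frobenius-homo-+ (suc j) x y = begin
    (x + y) ^ (2 ℕ.* 2^j)                 ≡⟨ ^-assocʳ (x + y) 2 2^j ⟨
    ((x + y) ^ 2) ^ 2^j                   ≡⟨ cong (_^ 2^j) (solve 2 (λ x y → (x :+ y) :^ 2 := x :^ 2 :+ y :^ 2) refl x y) ⟩
    (x ^ 2 + y ^ 2) ^ 2^j                 ≡⟨ frobenius-homo-+ j (x ^ 2) (y ^ 2) ⟩
    (x ^ 2) ^ 2^j + (y ^ 2) ^ 2^j         ≡⟨ cong₂ _+_ (^-assocʳ x 2 2^j) (^-assocʳ y 2 2^j) ⟩
    x ^ (2 ℕ.* 2^j) + y ^ (2 ℕ.* 2^j)     ∎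
    where 2^j = 2 ℕ.^ j

  trace[t²+t] : ∀ i t → trace i (t ^ 2 + t) ≡ t ^ (2 ℕ.^ i) + t
  trace[t²+t] zero    t = solve 1 (λ t → con false := t :^ 1 :+ t) refl t
  trace[t²+t] (suc i) t = begin
    trace i (t ^ 2 + t) + (t ^ 2 + t) ^ 2^i
      ≡⟨ cong₂ _+_ (trace[t²+t] i t) (frobenius-homo-+ i (t ^ 2) t) ⟩
    (t ^ 2^i + t) + ((t ^ 2) ^ 2^i + t ^ 2^i)
      ≡⟨ solve 3 (λ a t b → (a :+ t) :+ (b :+ a) := b :+ t) refl (t ^ 2^i) t ((t ^ 2) ^ 2^i) ⟩
    (t ^ 2) ^ 2^i + t
      ≡⟨ cong (_+ t) (^-assocʳ t 2 2^i) ⟩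
    t ^ (2 ℕ.* 2^i) + t
      ∎
    where 2^i = 2 ℕ.^ i

  -- Additive Hilbert 90, easy half: the trace kills every t ^ 2 + t.
  trace≡1⇒irreducible : ∀ e {δ} → n ≡ 2 ℕ.^ e → trace e δ ≡ 1# → ∀ t → ¬ t ^ 2 + t ≡ δ
  trace≡1⇒irreducible e {δ} n≡2^e trδ≡1 t t²+t≡δ = 0≢1 (begin
    0#                     ≡⟨ x+x≡0 t ⟨
    t + t                  ≡⟨ cong (_+ t) (trans (cong (t ^_) (sym n≡2^e)) (fermat t)) ⟨
    t ^ (2 ℕ.^ e) + t      ≡⟨ trace[t²+t] e t ⟨
    trace e (t ^ 2 + t)    ≡⟨ cong (trace e) t²+t≡δ ⟩
    trace e δ              ≡⟨ trδ≡1 ⟩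
    1#                     ∎)

  ^[2^[k+1]+2]-injective : ∀ k {x y} → n ≡ 2 ℕ.^ (2 ℕ.* k ℕ.+ 1) →
    x ^ (2 ℕ.^ (k ℕ.+ 1) ℕ.+ 2) ≡ y ^ (2 ℕ.^ (k ℕ.+ 1) ℕ.+ 2) → x ≡ y
  ^[2^[k+1]+2]-injective k {x} {y} n≡q x^σ+2≡y^σ+2 =
    ^[2^k+1]-injective k n≡q (square-injective (begin
      (x ^ c) ^ 2                   ≡⟨ ^-assocʳ x c 2 ⟩
      x ^ (c ℕ.* 2)                 ≡⟨ cong (x ^_) (2^[k+1]+2≡[2^k+1]*2 k) ⟨
      x ^ (2 ℕ.^ (k ℕ.+ 1) ℕ.+ 2)   ≡⟨ x^σ+2≡y^σ+2 ⟩
      y ^ (2 ℕ.^ (k ℕ.+ 1) ℕ.+ 2)   ≡⟨ cong (y ^_) (2^[k+1]+2≡[2^k+1]*2 k) ⟩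
      y ^ (c ℕ.* 2)                 ≡⟨ ^-assocʳ y c 2 ⟨
      (y ^ c) ^ 2                   ∎))
    where c = 2 ℕ.^ k ℕ.+ 1

  onC-at-infinity : ∀ σ .{{_ : NonZero σ}} x₁ x₂ x₃ x₄ x₅ x₆ →
                    onC σ 0# x₁ x₂ x₃ x₄ x₅ x₆ ⇔ x₁ ^ (σ ℕ.+ 2) ≡ x₃ ^ (σ ℕ.+ 2)
  onC-at-infinity (suc s) x₁ x₂ x₃ x₄ x₅ x₆ = mk⇔
    (λ onC₀ → x+y≡0⇒x≡y (trans (sym rhs) (trans (sym onC₀) lhs)))
    (λ eq → trans lhs (sym (trans rhs (x≡y⇒x+y≡0 eq))))
    where
    σ = suc s
    lhs : 0# ^ (σ ℕ.+ 1) * x₆ ≡ 0#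
    lhs = solve 2 (λ z x₆ → con false :* z :* x₆ := con false) refl (0# ^ (s ℕ.+ 1)) x₆
    rhs : x₁ ^ (σ ℕ.+ 2) + 0# ^ σ * x₁ * x₂ + 0# ^ 2 * x₂ ^ σ
          + x₃ ^ (σ ℕ.+ 2) + 0# ^ σ * x₃ * x₄ + 0# ^ 2 * x₄ ^ σ
          ≡ x₁ ^ (σ ℕ.+ 2) + x₃ ^ (σ ℕ.+ 2)
    rhs = solve 9
      (λ a b z x₁ x₂ x₃ x₄ y₂ y₄ →
         a :+ con false :* z :* x₁ :* x₂ :+ con false :^ 2 :* y₂
         :+ b :+ con false :* z :* x₃ :* x₄ :+ con false :^ 2 :* y₄
         := a :+ b)
      refl (x₁ ^ (σ ℕ.+ 2)) (x₃ ^ (σ ℕ.+ 2)) (0# ^ s) x₁ x₂ x₃ x₄ (x₂ ^ σ) (x₄ ^ σ)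

  module QuadraticExtension (δ : Carrier) (irreducible : ∀ t → ¬ t ^ 2 + t ≡ δ) where

    ε : F2
    ε = 0# , 1#

    δ≢0 : ¬ δ ≡ 0#
    δ≢0 δ≡0 = irreducible 0# (trans (solve 0 (con false :^ 2 :+ con false := con false) refl) (sym δ≡0))

    mul₂ₚ : ∀ {m} → Polynomial m → Polynomial m × Polynomial m → Polynomial m × Polynomial m →
            Polynomial m × Polynomial m
    mul₂ₚ d (a₀ , a₁) (b₀ , b₁) = a₀ :* b₀ :+ :- (d :* (a₁ :* b₁)) , a₀ :* b₁ :+ a₁ :* b₀ :+ :- (a₁ :* b₁)

    mul₂-assoc : ∀ u v w → mul₂ δ (mul₂ δ u v) w ≡ mul₂ δ u (mul₂ δ v w)
    mul₂-assoc (a₀ , a₁) (b₀ , b₁) (c₀ , c₁) = cong₂ _,_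
      (solve 7 (λ d a₀ a₁ b₀ b₁ c₀ c₁ →
        proj₁ (mul₂ₚ d (mul₂ₚ d (a₀ , a₁) (b₀ , b₁)) (c₀ , c₁))
          := proj₁ (mul₂ₚ d (a₀ , a₁) (mul₂ₚ d (b₀ , b₁) (c₀ , c₁)))) refl δ a₀ a₁ b₀ b₁ c₀ c₁)
      (solve 7 (λ d a₀ a₁ b₀ b₁ c₀ c₁ →
        proj₂ (mul₂ₚ d (mul₂ₚ d (a₀ , a₁) (b₀ , b₁)) (c₀ , c₁))
          := proj₂ (mul₂ₚ d (a₀ , a₁) (mul₂ₚ d (b₀ , b₁) (c₀ , c₁)))) refl δ a₀ a₁ b₀ b₁ c₀ c₁)

    mul₂-identityˡ : ∀ u → mul₂ δ 1₂ u ≡ u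
    mul₂-identityˡ (a₀ , a₁) = cong₂ _,_
      (solve 3 (λ d a₀ a₁ → proj₁ (mul₂ₚ d (con true , con false) (a₀ , a₁)) := a₀) refl δ a₀ a₁)
      (solve 3 (λ d a₀ a₁ → proj₂ (mul₂ₚ d (con true , con false) (a₀ , a₁)) := a₁) refl δ a₀ a₁)

    mul₂-identityʳ : ∀ u → mul₂ δ u 1₂ ≡ u
    mul₂-identityʳ (a₀ , a₁) = cong₂ _,_
      (solve 3 (λ d a₀ a₁ → proj₁ (mul₂ₚ d (a₀ , a₁) (con true , con false)) := a₀) refl δ a₀ a₁)
      (solve 3 (λ d a₀ a₁ → proj₂ (mul₂ₚ d (a₀ , a₁) (con true , con false)) := a₁) refl δ a₀ a₁)

    mul₂-zeroʳ : ∀ u → mul₂ δ u 0₂ ≡ 0₂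
    mul₂-zeroʳ (a₀ , a₁) = cong₂ _,_
      (solve 3 (λ d a₀ a₁ → proj₁ (mul₂ₚ d (a₀ , a₁) (con false , con false)) := con false) refl δ a₀ a₁)
      (solve 3 (λ d a₀ a₁ → proj₂ (mul₂ₚ d (a₀ , a₁) (con false , con false)) := con false) refl δ a₀ a₁)

    proj₁-mul₂-ε : ∀ u → proj₁ (mul₂ δ ε u) ≡ δ * proj₂ u
    proj₁-mul₂-ε (a₀ , a₁) =
      solve 3 (λ d a₀ a₁ → proj₁ (mul₂ₚ d (con false , con true) (a₀ , a₁)) := d :* a₁) refl δ a₀ a₁

    norm : F2 → Carrier
    norm (a , b) = a * a + a * b + δ * (b * b)

    -- For b ≢ 0 the norm is b² (t² + t + δ) with t = a / b.
    norm-≢0 : ∀ {u} → ¬ u ≡ 0₂ → ¬ norm u ≡ 0#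
    norm-≢0 {a , b} u≢0 Nu≡0 with b ≟ 0#
    ... | yes refl = u≢0 (cong (_, 0#) (^≡0⇒≡0 2 (trans a²≡N Nu≡0)))
      where
      a²≡N : a ^ 2 ≡ norm (a , 0#)
      a²≡N = solve 2 (λ d a → a :^ 2 := a :* a :+ a :* con false :+ d :* (con false :* con false)) refl δ a
    ... | no b≢0 = irreducible t (x+y≡0⇒x≡y (*-cancelʳ-≢0 (*-≢0 b≢0 b≢0) (begin
        (t ^ 2 + t + δ) * (b * b)     ≡⟨ solve 3 (λ d t b → (t :^ 2 :+ t :+ d) :* (b :* b)
                                                := (b :* t) :* (b :* t) :+ (b :* t) :* b :+ d :* (b :* b)) refl δ t b ⟩
        norm (b * t , b)              ≡⟨ cong (λ x → norm (x , b)) (inverse-cancelˡ b≢0 a) ⟩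
        norm (a , b)                  ≡⟨ Nu≡0 ⟩
        0#                            ≡⟨ zeroˡ _ ⟨
        0# * (b * b)                  ∎)))
      where
      t = inv b b≢0 * a

    -- The inverse of a + ε b is its conjugate (a + b) + ε b divided by the norm.
    mul₂-inverse : ∀ {u} → ¬ u ≡ 0₂ → Σ F2 (λ u⁻¹ → mul₂ δ u u⁻¹ ≡ 1₂)
    mul₂-inverse {a , b} u≢0 = ((a + b) * c , b * c) , (begin
      mul₂ δ (a , b) ((a + b) * c , b * c)   ≡⟨ cong₂ _,_
        (solve 4 (λ d a b c → proj₁ (mul₂ₚ d (a , b) ((a :+ b) :* c , b :* c))
                             := (a :* a :+ a :* b :+ d :* (b :* b)) :* c) refl δ a b c)
        (solve 4 (λ d a b c → proj₂ (mul₂ₚ d (a , b) ((a :+ b) :* c , b :* c))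
                             := con false) refl δ a b c) ⟩
      norm (a , b) * c , 0#                  ≡⟨ cong (_, 0#) (*-inverseʳ (norm-≢0 u≢0)) ⟩
      1₂                                     ∎)
      where c = inv (norm (a , b)) (norm-≢0 u≢0)

    mul₂-divides : ∀ {u} → ¬ u ≡ 0₂ → ∀ w → Σ F2 (λ h → mul₂ δ u h ≡ w)
    mul₂-divides {u} u≢0 w = mul₂ δ u⁻¹ w , (begin
      mul₂ δ u (mul₂ δ u⁻¹ w)   ≡⟨ mul₂-assoc u u⁻¹ w ⟨
      mul₂ δ (mul₂ δ u u⁻¹) w   ≡⟨ cong (λ v → mul₂ δ v w) uu⁻¹≡1 ⟩
      mul₂ δ 1₂ w               ≡⟨ mul₂-identityˡ w ⟩
      w                         ∎)
      where
      u⁻¹ = proj₁ (mul₂-inverse u≢0)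
      uu⁻¹≡1 = proj₂ (mul₂-inverse u≢0)

    OnLineX≡Y : F2 → F2 → F2 → Set
    OnLineX≡Y u v w = SamePoint δ u v w 0₂ 0₂ 1₂ ⊎ Σ F2 (λ h → SamePoint δ u v w 1₂ 1₂ h)

    onLineX≡Y⇒≡ : ∀ {u v w} → OnLineX≡Y u v w → u ≡ v
    onLineX≡Y⇒≡ (inj₁ (_ , _ , μ0≡u , μ0≡v , _))     = trans (sym μ0≡u) μ0≡v
    onLineX≡Y⇒≡ (inj₂ (_ , _ , _ , μ1≡u , μ1≡v , _)) = trans (sym μ1≡u) μ1≡v

    diagonal-onLineX≡Y : ∀ {u w} → NonZero3 u u w → OnLineX≡Y u u w
    diagonal-onLineX≡Y {u} {w} nz with ≡-dec _≟_ _≟_ u 0₂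
    ... | yes u≡0 = inj₁ (w , w≢0 , w0≡u , w0≡u , mul₂-identityʳ w)
      where
      w≢0 : ¬ w ≡ 0₂
      w≢0 w≡0 = nz (u≡0 , u≡0 , w≡0)
      w0≡u : mul₂ δ w 0₂ ≡ u
      w0≡u = trans (mul₂-zeroʳ w) (sym u≡0)
    ... | no u≢0 = inj₂ (proj₁ (mul₂-divides u≢0 w) ,
                         u , u≢0 , mul₂-identityʳ u , mul₂-identityʳ u , proj₂ (mul₂-divides u≢0 w))

    ≡⇔onLineX≡Y : ∀ {u v w} → NonZero3 u v w → u ≡ v ⇔ OnLineX≡Y u v w
    ≡⇔onLineX≡Y nz = mk⇔ (λ { refl → diagonal-onLineX≡Y nz }) onLineX≡Y⇒≡

    lineInC⇔≡ : ∀ σ .{{_ : NonZero σ}} → (∀ {x y} → x ^ (σ ℕ.+ 2) ≡ y ^ (σ ℕ.+ 2) → x ≡ y) →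
                ∀ {u v w} → LineInC σ δ u v w ⇔ u ≡ v
    lineInC⇔≡ σ ^[σ+2]-injective {u} {v} {w} = mk⇔
      (λ line → cong₂ _,_
        (begin
          proj₁ u                   ≡⟨ cong proj₁ (mul₂-identityˡ u) ⟨
          proj₁ (mul₂ δ 1₂ u)       ≡⟨ first-coordinates line 1₂ (λ 1₂≡0 → 1≢0 (cong proj₁ 1₂≡0)) ⟩
          proj₁ (mul₂ δ 1₂ v)       ≡⟨ cong proj₁ (mul₂-identityˡ v) ⟩
          proj₁ v                   ∎)
        (*-cancelˡ-≢0 δ≢0 (begin
          δ * proj₂ u               ≡⟨ proj₁-mul₂-ε u ⟨
          proj₁ (mul₂ δ ε u)        ≡⟨ first-coordinates line ε (λ ε≡0 → 1≢0 (cong proj₂ ε≡0)) ⟩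
          proj₁ (mul₂ δ ε v)        ≡⟨ proj₁-mul₂-ε v ⟩
          δ * proj₂ v               ∎)))
      (λ { refl λ′ _ → Equivalence.from (onC-at-infinity σ _ _ _ _ (proj₁ (mul₂ δ λ′ w)) _) refl })
      where
      -- onC does not mention x₅, so that coordinate has to be supplied.
      first-coordinates : LineInC σ δ u v w → ∀ λ′ → ¬ λ′ ≡ 0₂ →
                          proj₁ (mul₂ δ λ′ u) ≡ proj₁ (mul₂ δ λ′ v)
      first-coordinates line λ′ λ′≢0 =
        ^[σ+2]-injective (Equivalence.to (onC-at-infinity σ _ _ _ _ (proj₁ (mul₂ δ λ′ w)) _) (line λ′ λ′≢0))

open import Data.Nat using (_<_; _^_; _+_; _*_)

proposition7p3 : (e k : ℕ) → 1 < e → e ≡ 2 * k + 1 →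
    (F : FiniteField (2 ^ e)) →
    (δ : FiniteField.Carrier F) → FieldOps.trace F e δ ≡ FiniteField.1# F →
    (u v w : FieldOps.F2 F) → FieldOps.NonZero3 F u v w →
    FieldOps.LineInC F (2 ^ (k + 1)) δ u v w
      ⇔ (FieldOps.SamePoint F δ u v w (FieldOps.0₂ F) (FieldOps.0₂ F) (FieldOps.1₂ F)
         ⊎ Σ (FieldOps.F2 F) (λ h → FieldOps.SamePoint F δ u v w (FieldOps.1₂ F) (FieldOps.1₂ F) h))
proposition7p3 e k _ refl F δ trδ≡1 u v w nz =
  ≡⇔onLineX≡Y nz ⇔-∘ lineInC⇔≡ (2 ^ (k + 1)) {{ℕ.m^n≢0 2 (k + 1)}} (^[2^[k+1]+2]-injective k refl)
  where
  open FiniteFieldProperties F using (characteristic-two)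
  open CharacteristicTwo F (characteristic-two (2 ^ k * 2 ^ k)
                          (trans (2^[2k+1]≡2^k*2^k*2 k) (ℕ.*-comm (2 ^ k * 2 ^ k) 2)))
  open QuadraticExtension δ (trace≡1⇒irreducible (2 * k + 1) refl trδ≡1)
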